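{- Fix positive integers $r,s$. Identify $\mathbf{Rec}$ with the set of integer triples $(x,y,z)$ with $x\le 0$, $y\ge 0$, $x\le z\le y$ as in the context. Then the generalized rotor-router map $f_{r,s}$ acts on $\mathbf{Rec}$ by $$f_{r,s}(x,y,z)=\begin{cases}(x,\;y+s,\;z-y) & \text{if } x+y\le z,\\ (x-r,\;y,\;z-x+1) & \text{if } x+y>z.\end{cases}$$
   Context: For integers $a\le b$, $[a,b]=\{k\in\mathbb{Z}: a\le k\le b\}$. Fix positive integers $r,s$. A state consists of integers $x\le 0\le y$ (occupied interval $[x,y]$) and a labeling $[x,y]\to\{L,R\}$; $\Sigma$ is the set of all states. The map $f_{r,s}:\Sigma\to\Sigma$: a particle starts at $0$; at an occupied site $k$ it moves to $k-1$ if the label at $k$ is $L$ and to $k+1$ if it is $R$, and the label at $k$ is then switched; when it first reaches an unoccupied site, if this is the site just left of the occupied interval $[a,b]$ (i.e. $a-1$) the sites $[a-r,a-1]$ become occupied with label $R$, and if it is $b+1$ the sites $[b+1,b+s]$ become occupied with label $R$. $\mathbf{Rec}$ is the set of states whose occupied interval is $[x,y+s-1]$ for some integers $x\le 0\le y$ and whose labels are: $R$ on $[x,z-1]$, $L$ on $[z,y-1]$, $R$ on $[y,y+s-1]$, for some integer $z$ with $x\le z\le y$. Such a state is identified with the triple $(x,y,z)$: $x$ is the first occupied site, $y$ the first site of the final block of $s$ sites labeled $R$, and $z$ the first site labeled $L$ (with the convention $z=y$ if no site of $[x,y-1]$ is labeled $L$). -}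

module Defs where

open import Data.Nat using (ℕ)
open import Data.Integer using (ℤ; +_; _+_; _-_; _≤_; _<_; _<?_; _≟_; 0ℤ; 1ℤ)
open import Data.Product using (Σ; _×_; _,_)
open import Relation.Nullary using (yes; no)
open import Relation.Binary.PropositionalEquality using (_≡_)

data Label : Set where
  L R : Label

switch : Label → Label
switch L = R
switch R = L

-- A state: occupied interval [x , y] and a labeling. The labeling is a total
-- function ℤ → Label, but only its values on [x , y] are meaningful; states
-- are compared with _≈S_, which ignores labels outside the occupied interval.
record State : Set where
  constructor st
  field
    lo  : ℤ
    hi  : ℤ
    lab : ℤ → Label
open State public

_≈S_ : State → State → Set
σ ≈S τ = (lo σ ≡ lo τ) × (hi σ ≡ hi τ)
       × (∀ k → lo σ ≤ k → k ≤ hi σ → lab σ k ≡ lab τ k)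

flipAt : (ℤ → Label) → ℤ → (ℤ → Label)
flipAt ℓ p k with k ≟ p
... | yes _ = switch (ℓ p)
... | no  _ = ℓ k

-- Labels R on all sites left of a (used for the new sites [a-r, a-1]).
extendLeft : ℤ → (ℤ → Label) → (ℤ → Label)
extendLeft a ℓ k with k <? a
... | yes _ = R
... | no  _ = ℓ k

-- Labels R on all sites right of b (used for the new sites [b+1, b+s]).
extendRight : ℤ → (ℤ → Label) → (ℤ → Label)
extendRight b ℓ k with b <? k
... | yes _ = R
... | no  _ = ℓ k

-- Run r s x y ℓ p τ : the particle currently at site p, in the configuration
-- with occupied interval [x , y] and labeling ℓ, continues its walk and the
-- process ends in the state τ.  (The walk is deterministic, so this relation
-- is the graph of the process.)
data Run (r s : ℕ) (x y : ℤ) : (ℤ → Label) → ℤ → State → Set where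
  exitLeft  : ∀ {ℓ p} → p ≡ x - 1ℤ →
              Run r s x y ℓ p (st (x - + r) y (extendLeft x ℓ))
  exitRight : ∀ {ℓ p} → p ≡ y + 1ℤ →
              Run r s x y ℓ p (st x (y + + s) (extendRight y ℓ))
  stepL : ∀ {ℓ p τ} → x ≤ p → p ≤ y → ℓ p ≡ L →
          Run r s x y (flipAt ℓ p) (p - 1ℤ) τ → Run r s x y ℓ p τ
  stepR : ∀ {ℓ p τ} → x ≤ p → p ≤ y → ℓ p ≡ R →
          Run r s x y (flipAt ℓ p) (p + 1ℤ) τ → Run r s x y ℓ p τ

-- f_{r,s}(σ) = τ : the particle starting at 0 in σ ends the process in τ.
FMap : (r s : ℕ) → State → State → Set
FMap r s σ τ = Run r s (lo σ) (hi σ) (lab σ) 0ℤ τ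

_,_⊢f_≈_ : (r s : ℕ) → State → State → Set
_,_⊢f_≈_ r s σ τ = Σ State (λ τ' → FMap r s σ τ' × τ' ≈S τ)

-- The element of Rec identified with the triple (x , y , z):
-- occupied interval [x , y+s-1]; R on [x,z-1], L on [z,y-1], R on [y,y+s-1].
recLab : ℤ → ℤ → (ℤ → Label)
recLab y z k with k <? z
... | yes _ = R
... | no  _ with k <? y
...   | yes _ = L
...   | no  _ = R

recState : (s : ℕ) → ℤ → ℤ → ℤ → State
recState s x y z = st x (y + + s - 1ℤ) (recLab y z)

-- The labelling of the Rec state (x, y, z) is L on [z, y) and R elsewhere. Along the
-- walk, whenever the particle crosses a site p from the left, the labelling is L exactly
-- on [a, p) ∪ [c, y) for some a ≤ p ≤ c with a + c = z; initially (a, c) is (z, 0) or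
-- (0, z). The particle runs right over the R-block [p, c), turns at the L on c, runs back
-- over the now all-L block [a, c] and turns at a - 1: the invariant is restored with
-- (a - 1, c + 1). The walk leaves through the right end once c = y, which happens first
-- iff x + y ≤ z, and then a = z - y; otherwise it leaves through the left end once a = x,
-- and then c = z - x. In both cases the labels left behind are those of the claimed triple.

module Submission where

open import Defs
open import Data.Nat using (ℕ; zero; suc)
open import Data.Integer using (ℤ; +_; _+_; _-_; _≤_; _<_; 0ℤ; 1ℤ; ∣_∣; _<?_; _≟_)
open import Data.Integer.Properties
  using (≤-refl; ≤-reflexive; ≤-trans; <⇒≤; <⇒≱; ≮⇒≥; ≰⇒>; ≤∧≢⇒<; <-≤-trans; ≤-<-trans;
         +-mono-≤; +-mono-<-≤; +-comm; +-assoc; +-identityˡ; +-identityʳ; i≤i+j;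
         i≤j⇒0≤j-i; 0≤i⇒+∣i∣≡i; suc[i]≤j⇒i<j; i<j⇒suc[i]≤j)
open import Data.Integer.Tactic.RingSolver using (solve-∀)
open import Data.Product using (Σ; ∃; _×_; _,_; proj₁; proj₂; map₁; map₂)
open import Data.Sum using (_⊎_; inj₁; inj₂)
open import Data.Empty using (⊥-elim)
open import Function using (_$_)
open import Relation.Nullary using (yes; no)
open import Relation.Binary.PropositionalEquality

private
  i-1+1≡i : ∀ i → i - 1ℤ + 1ℤ ≡ i
  i-1+1≡i = solve-∀

  i+1-1≡i : ∀ i → i + 1ℤ - 1ℤ ≡ i
  i+1-1≡i = solve-∀

  i+[1+j]-1≡i+j : ∀ i j → i + (1ℤ + j) - 1ℤ ≡ i + j
  i+[1+j]-1≡i+j = solve-∀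

  i-1+[j+1]≡i+j : ∀ i j → i - 1ℤ + (j + 1ℤ) ≡ i + j
  i-1+[j+1]≡i+j = solve-∀

  i+[j-i]≡j : ∀ i j → i + (j - i) ≡ j
  i+[j-i]≡j = solve-∀

  i+j-i≡j : ∀ i j → i + j - i ≡ j
  i+j-i≡j = solve-∀

  i+j-j≡i : ∀ i j → i + j - j ≡ i
  i+j-j≡i = solve-∀

  i+j-1+j≡i+j+j-1 : ∀ i j → i + j - 1ℤ + j ≡ i + j + j - 1ℤ
  i+j-1+j≡i+j+j-1 = solve-∀

<⊎≥ : ∀ i j → i < j ⊎ j ≤ i
<⊎≥ i j with i <? j
... | yes i<j = inj₁ i<j
... | no  i≮j = inj₂ (≮⇒≥ i≮j)

<⇒+1≤ : ∀ {i j} → i < j → i + 1ℤ ≤ j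
<⇒+1≤ {i} i<j = subst (_≤ _) (+-comm 1ℤ i) (i<j⇒suc[i]≤j i<j)

+1≤⇒< : ∀ {i j} → i + 1ℤ ≤ j → i < j
+1≤⇒< {i} i+1≤j = suc[i]≤j⇒i<j (subst (_≤ _) (+-comm i 1ℤ) i+1≤j)

<+1⇒≤ : ∀ {i j} → i < j + 1ℤ → i ≤ j
<+1⇒≤ i<j+1 = ≮⇒≥ (λ j<i → <⇒≱ i<j+1 (<⇒+1≤ j<i))

i<i+1 : ∀ i → i < i + 1ℤ
i<i+1 i = +1≤⇒< ≤-refl

i≤i+1 : ∀ i → i ≤ i + 1ℤ
i≤i+1 i = <⇒≤ (i<i+1 i)

i-1≤i : ∀ i → i - 1ℤ ≤ i
i-1≤i i = <⇒≤ (+1≤⇒< (≤-reflexive (i-1+1≡i i)))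

≤⇒∃+ : ∀ {i j} → i ≤ j → ∃ λ n → i + + n ≡ j
≤⇒∃+ {i} {j} i≤j =
  ∣ j - i ∣ , trans (cong (λ t → i + t) (0≤i⇒+∣i∣≡i (i≤j⇒0≤j-i i≤j))) (i+[j-i]≡j i j)

i+j≤k+l∧l≤j⇒i≤k : ∀ {i j k l} → i + j ≤ k + l → l ≤ j → i ≤ k
i+j≤k+l∧l≤j⇒i≤k i+j≤k+l l≤j = ≮⇒≥ (λ k<i → <⇒≱ (+-mono-<-≤ k<i l≤j) i+j≤k+l)

i+j<k+l∧k≤i⇒j<l : ∀ {i j k l} → i + j < k + l → k ≤ i → j < l
i+j<k+l∧k≤i⇒j<l i+j<k+l k≤i = ≰⇒> (λ l≤j → <⇒≱ i+j<k+l (+-mono-≤ k≤i l≤j))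

paint : Label → ℤ → ℤ → (ℤ → Label) → (ℤ → Label)
paint v a b ℓ k with k <? a
... | yes _ = ℓ k
... | no  _ with k <? b
...   | yes _ = v
...   | no  _ = ℓ k

module _ {v : Label} {a b : ℤ} {ℓ : ℤ → Label} {k : ℤ} where

  paint-below : k < a → paint v a b ℓ k ≡ ℓ k
  paint-below k<a with k <? a
  ... | yes _   = refl
  ... | no  k≮a = ⊥-elim (k≮a k<a)

  paint-inside : a ≤ k → k < b → paint v a b ℓ k ≡ v
  paint-inside a≤k k<b with k <? a
  ... | yes k<a = ⊥-elim (<⇒≱ k<a a≤k)
  ... | no  _ with k <? b
  ...   | yes _   = refl
  ...   | no  k≮b = ⊥-elim (k≮b k<b)

  paint-above : b ≤ k → paint v a b ℓ k ≡ ℓ k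
  paint-above b≤k with k <? a
  ... | yes _ = refl
  ... | no  _ with k <? b
  ...   | yes k<b = ⊥-elim (<⇒≱ k<b b≤k)
  ...   | no  _   = refl

paint-empty : ∀ {v a ℓ} → paint v a a ℓ ≗ ℓ
paint-empty {a = a} k with <⊎≥ k a
... | inj₁ k<a = paint-below k<a
... | inj₂ a≤k = paint-above a≤k

paint-mergeʳ : ∀ {v a b c ℓ} → a ≤ b → b ≤ c → paint v b c (paint v a b ℓ) ≗ paint v a c ℓ
paint-mergeʳ {a = a} {b} {c} a≤b b≤c k with <⊎≥ k b
... | inj₁ k<b with <⊎≥ k a
...   | inj₁ k<a = trans (trans (paint-below k<b) (paint-below k<a)) (sym (paint-below k<a))
...   | inj₂ a≤k = trans (trans (paint-below k<b) (paint-inside a≤k k<b))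
                         (sym (paint-inside a≤k (<-≤-trans k<b b≤c)))
paint-mergeʳ {a = a} {b} {c} a≤b b≤c k | inj₂ b≤k with <⊎≥ k c
...   | inj₁ k<c = trans (paint-inside b≤k k<c) (sym (paint-inside (≤-trans a≤b b≤k) k<c))
...   | inj₂ c≤k = trans (trans (paint-above c≤k) (paint-above b≤k)) (sym (paint-above c≤k))

paint-mergeˡ : ∀ {v a b c ℓ} → a ≤ b → b ≤ c → paint v a b (paint v b c ℓ) ≗ paint v a c ℓ
paint-mergeˡ {a = a} {b} {c} a≤b b≤c k with <⊎≥ k b
... | inj₁ k<b with <⊎≥ k a
...   | inj₁ k<a = trans (trans (paint-below k<a) (paint-below k<b)) (sym (paint-below k<a))
...   | inj₂ a≤k = trans (paint-inside a≤k k<b) (sym (paint-inside a≤k (<-≤-trans k<b b≤c)))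
paint-mergeˡ {a = a} {b} {c} a≤b b≤c k | inj₂ b≤k with <⊎≥ k c
...   | inj₁ k<c = trans (trans (paint-above b≤k) (paint-inside b≤k k<c))
                         (sym (paint-inside (≤-trans a≤b b≤k) k<c))
...   | inj₂ c≤k = trans (trans (paint-above b≤k) (paint-above c≤k)) (sym (paint-above c≤k))

paint-absorb : ∀ {v w a b a′ b′ ℓ} → a ≤ a′ → b′ ≤ b →
               paint v a b (paint w a′ b′ ℓ) ≗ paint v a b ℓ
paint-absorb {a = a} {b} a≤a′ b′≤b k with <⊎≥ k a
... | inj₁ k<a = trans (trans (paint-below k<a) (paint-below (<-≤-trans k<a a≤a′)))
                       (sym (paint-below k<a))
... | inj₂ a≤k with <⊎≥ k b
...   | inj₁ k<b = trans (paint-inside a≤k k<b) (sym (paint-inside a≤k k<b))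
...   | inj₂ b≤k = trans (trans (paint-above b≤k) (paint-above (≤-trans b′≤b b≤k)))
                         (sym (paint-above b≤k))

recLab≗paint : ∀ y z → recLab y z ≗ paint L z y (λ _ → R)
recLab≗paint y z k with k <? z
... | yes _ = refl
... | no  _ with k <? y
...   | yes _ = refl
...   | no  _ = refl

module _ {y z k : ℤ} where

  recLab-below : k < z → recLab y z k ≡ R
  recLab-below k<z = trans (recLab≗paint y z k) (paint-below k<z)

  recLab-middle : z ≤ k → k < y → recLab y z k ≡ L
  recLab-middle z≤k k<y = trans (recLab≗paint y z k) (paint-inside z≤k k<y)

  recLab-above : y ≤ k → recLab y z k ≡ R
  recLab-above y≤k = trans (recLab≗paint y z k) (paint-above y≤k)

recLab-diag : ∀ y k → recLab y y k ≡ R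
recLab-diag y k with <⊎≥ k y
... | inj₁ k<y = recLab-below k<y
... | inj₂ y≤k = recLab-above y≤k

recLab-beyond : ∀ {y z z′ k} → z ≤ k → z′ ≤ k → recLab y z k ≡ recLab y z′ k
recLab-beyond {y} {k = k} z≤k z′≤k with <⊎≥ k y
... | inj₁ k<y = trans (recLab-middle z≤k k<y) (sym (recLab-middle z′≤k k<y))
... | inj₂ y≤k = trans (recLab-above y≤k) (sym (recLab-above y≤k))

recLab-raise : ∀ {y a z z′} → a ≤ z → z ≤ z′ → paint R a z′ (recLab y z) ≗ recLab y z′
recLab-raise {a = a} {z′ = z′} a≤z z≤z′ k with <⊎≥ k a
... | inj₁ k<a = trans (trans (paint-below k<a) (recLab-below (<-≤-trans k<a a≤z)))
                       (sym (recLab-below (<-≤-trans k<a (≤-trans a≤z z≤z′))))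
... | inj₂ a≤k with <⊎≥ k z′
...   | inj₁ k<z′ = trans (paint-inside a≤k k<z′) (sym (recLab-below k<z′))
...   | inj₂ z′≤k = trans (paint-above z′≤k) (recLab-beyond (≤-trans z≤z′ z′≤k) z′≤k)

recLab-lower : ∀ {y a c} → a ≤ c → c ≤ y → paint L a c (recLab y c) ≗ recLab y a
recLab-lower {a = a} {c} a≤c c≤y k with <⊎≥ k a
... | inj₁ k<a = trans (trans (paint-below k<a) (recLab-below (<-≤-trans k<a a≤c)))
                       (sym (recLab-below k<a))
... | inj₂ a≤k with <⊎≥ k c
...   | inj₁ k<c = trans (paint-inside a≤k k<c) (sym (recLab-middle a≤k (<-≤-trans k<c c≤y)))
...   | inj₂ c≤k = trans (paint-above c≤k) (recLab-beyond c≤k a≤k)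

paint-recLab-diag : ∀ {y a b} → paint L a b (recLab y y) ≗ recLab b a
paint-recLab-diag {y} {a} {b} k with <⊎≥ k a
... | inj₁ k<a = trans (trans (paint-below k<a) (recLab-diag y k)) (sym (recLab-below k<a))
... | inj₂ a≤k with <⊎≥ k b
...   | inj₁ k<b = trans (paint-inside a≤k k<b) (sym (recLab-middle a≤k k<b))
...   | inj₂ b≤k = trans (trans (paint-above b≤k) (recLab-diag y k)) (sym (recLab-above b≤k))

flipAt≗paint : ∀ {ℓ p v} → ℓ p ≡ v → flipAt ℓ p ≗ paint (switch v) p (p + 1ℤ) ℓ
flipAt≗paint {p = p} ℓp≡v k with k ≟ p
... | yes refl = trans (cong switch ℓp≡v) (sym (paint-inside ≤-refl (i<i+1 k)))
... | no  k≢p with <⊎≥ k p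
...   | inj₁ k<p = sym (paint-below k<p)
...   | inj₂ p≤k = sym (paint-above (<⇒+1≤ (≤∧≢⇒< p≤k (λ p≡k → k≢p (sym p≡k)))))

flipAt-cong : ∀ {ℓ ℓ′} → ℓ ≗ ℓ′ → ∀ p → flipAt ℓ p ≗ flipAt ℓ′ p
flipAt-cong ℓ≗ℓ′ p k with k ≟ p
... | yes _ = cong switch (ℓ≗ℓ′ p)
... | no  _ = ℓ≗ℓ′ k

extendLeft-cong : ∀ {ℓ ℓ′} → ℓ ≗ ℓ′ → ∀ a → extendLeft a ℓ ≗ extendLeft a ℓ′
extendLeft-cong ℓ≗ℓ′ a k with k <? a
... | yes _ = refl
... | no  _ = ℓ≗ℓ′ k

extendRight-cong : ∀ {ℓ ℓ′} → ℓ ≗ ℓ′ → ∀ b → extendRight b ℓ ≗ extendRight b ℓ′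
extendRight-cong ℓ≗ℓ′ b k with b <? k
... | yes _ = refl
... | no  _ = ℓ≗ℓ′ k

extendLeft-id : ∀ {a ℓ} → (∀ k → k < a → ℓ k ≡ R) → extendLeft a ℓ ≗ ℓ
extendLeft-id {a} allR k with k <? a
... | yes k<a = sym (allR k k<a)
... | no  _   = refl

extendRight-id : ∀ b {ℓ} → (∀ k → b < k → ℓ k ≡ R) → extendRight b ℓ ≗ ℓ
extendRight-id b allR k with b <? k
... | yes b<k = sym (allR k b<k)
... | no  _   = refl

≈S-trans : ∀ {σ τ υ} → σ ≈S τ → τ ≈S υ → σ ≈S υ
≈S-trans (lo≡ , hi≡ , lab≡) (lo≡′ , hi≡′ , lab≡′) =
  trans lo≡ lo≡′ , trans hi≡ hi≡′ ,
  λ k lo≤k k≤hi → trans (lab≡ k lo≤k k≤hi)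
                        (lab≡′ k (subst (_≤ k) lo≡ lo≤k) (subst (k ≤_) hi≡ k≤hi))

Run-cong : ∀ {r s x h ℓ ℓ′ p τ} → ℓ ≗ ℓ′ → Run r s x h ℓ p τ →
           Σ State λ τ′ → Run r s x h ℓ′ p τ′ × τ′ ≈S τ
Run-cong {x = x} ℓ≗ℓ′ (exitLeft e) =
  _ , exitLeft e , refl , refl , λ k _ _ → sym (extendLeft-cong ℓ≗ℓ′ x k)
Run-cong {h = h} ℓ≗ℓ′ (exitRight e) =
  _ , exitRight e , refl , refl , λ k _ _ → sym (extendRight-cong ℓ≗ℓ′ h k)
Run-cong {p = p} ℓ≗ℓ′ (stepL x≤p p≤h ℓp≡L run) =
  map₂ (map₁ (stepL x≤p p≤h (trans (sym (ℓ≗ℓ′ p)) ℓp≡L))) (Run-cong (flipAt-cong ℓ≗ℓ′ p) run)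
Run-cong {p = p} ℓ≗ℓ′ (stepR x≤p p≤h ℓp≡R run) =
  map₂ (map₁ (stepR x≤p p≤h (trans (sym (ℓ≗ℓ′ p)) ℓp≡R))) (Run-cong (flipAt-cong ℓ≗ℓ′ p) run)

module Walk (r s : ℕ) (x h : ℤ) (T : State) where

  Reaches : (ℤ → Label) → ℤ → Set
  Reaches ℓ p = Σ State λ τ → Run r s x h ℓ p τ × τ ≈S T

  reaches-≗ : ∀ {ℓ ℓ′ p} → ℓ ≗ ℓ′ → Reaches ℓ′ p → Reaches ℓ p
  reaches-≗ ℓ≗ℓ′ (τ , run , τ≈T) =
    map₂ (map₂ (λ τ′≈τ → ≈S-trans τ′≈τ τ≈T)) (Run-cong (λ k → sym (ℓ≗ℓ′ k)) run)

  stepRight : ∀ {ℓ p} → x ≤ p → p ≤ h → ℓ p ≡ R →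
              Reaches (paint L p (p + 1ℤ) ℓ) (p + 1ℤ) → Reaches ℓ p
  stepRight x≤p p≤h ℓp≡R reach =
    map₂ (map₁ (stepR x≤p p≤h ℓp≡R)) (reaches-≗ (flipAt≗paint ℓp≡R) reach)

  stepLeft : ∀ {ℓ p} → x ≤ p → p ≤ h → ℓ p ≡ L →
             Reaches (paint R p (p + 1ℤ) ℓ) (p - 1ℤ) → Reaches ℓ p
  stepLeft x≤p p≤h ℓp≡L reach =
    map₂ (map₁ (stepL x≤p p≤h ℓp≡L)) (reaches-≗ (flipAt≗paint ℓp≡L) reach)

  sweepRight : ∀ {ℓ p q} → x ≤ p → p ≤ q → q ≤ h + 1ℤ → (∀ k → p ≤ k → k < q → ℓ k ≡ R) →
               Reaches (paint L p q ℓ) q → Reaches ℓ p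
  sweepRight x≤p p≤q = go (proj₁ (≤⇒∃+ p≤q)) (proj₂ (≤⇒∃+ p≤q)) x≤p
    where
    go : ∀ n {ℓ p q} → p + + n ≡ q → x ≤ p → q ≤ h + 1ℤ → (∀ k → p ≤ k → k < q → ℓ k ≡ R) →
         Reaches (paint L p q ℓ) q → Reaches ℓ p
    go zero {p = p} p+0≡q _ _ _ reach with trans (sym (+-identityʳ p)) p+0≡q
    ... | refl = reaches-≗ (λ k → sym (paint-empty k)) reach
    go (suc m) {ℓ} {p} {q} p+n≡q x≤p q≤h+1 allR reach =
      stepRight x≤p (<+1⇒≤ (<-≤-trans p<q q≤h+1)) (allR p ≤-refl p<q) $
      go m p+1+m≡q (≤-trans x≤p (i≤i+1 p)) q≤h+1 allR′ $
      reaches-≗ (paint-mergeʳ (i≤i+1 p) p+1≤q) reach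
      where
      p+1+m≡q : p + 1ℤ + + m ≡ q
      p+1+m≡q = trans (+-assoc p 1ℤ (+ m)) p+n≡q
      p+1≤q : p + 1ℤ ≤ q
      p+1≤q = subst (p + 1ℤ ≤_) p+1+m≡q (i≤i+j (p + 1ℤ) (+ m))
      p<q : p < q
      p<q = +1≤⇒< p+1≤q
      allR′ : ∀ k → p + 1ℤ ≤ k → k < q → paint L p (p + 1ℤ) ℓ k ≡ R
      allR′ k p+1≤k k<q = trans (paint-above p+1≤k) (allR k (≤-trans (i≤i+1 p) p+1≤k) k<q)

  sweepLeft : ∀ {ℓ p q} → x ≤ p → p ≤ q → q ≤ h + 1ℤ → (∀ k → p ≤ k → k < q → ℓ k ≡ L) →
              Reaches (paint R p q ℓ) (p - 1ℤ) → Reaches ℓ (q - 1ℤ)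
  sweepLeft x≤p p≤q = go (proj₁ (≤⇒∃+ p≤q)) (proj₂ (≤⇒∃+ p≤q)) x≤p
    where
    go : ∀ n {ℓ p q} → p + + n ≡ q → x ≤ p → q ≤ h + 1ℤ → (∀ k → p ≤ k → k < q → ℓ k ≡ L) →
         Reaches (paint R p q ℓ) (p - 1ℤ) → Reaches ℓ (q - 1ℤ)
    go zero {p = p} p+0≡q _ _ _ reach with trans (sym (+-identityʳ p)) p+0≡q
    ... | refl = reaches-≗ (λ k → sym (paint-empty k)) reach
    go (suc m) {ℓ} {p} {q} p+n≡q x≤p q≤h+1 allL reach =
      stepLeft (≤-trans x≤p p≤q-1) (<+1⇒≤ (<-≤-trans q-1<q q≤h+1)) (allL (q - 1ℤ) p≤q-1 q-1<q) $
      go m p+m≡q-1 x≤p (≤-trans (<⇒≤ q-1<q) q≤h+1) allL′ $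
      reaches-≗ (paint-mergeˡ p≤q-1 (i≤i+1 (q - 1ℤ))) $
      subst (λ t → Reaches (paint R p t ℓ) (p - 1ℤ)) (sym (i-1+1≡i q)) reach
      where
      p+m≡q-1 : p + + m ≡ q - 1ℤ
      p+m≡q-1 = trans (sym (i+[1+j]-1≡i+j p (+ m))) (cong (_- 1ℤ) p+n≡q)
      p≤q-1 : p ≤ q - 1ℤ
      p≤q-1 = subst (p ≤_) p+m≡q-1 (i≤i+j p (+ m))
      q-1<q : q - 1ℤ < q
      q-1<q = +1≤⇒< (≤-reflexive (i-1+1≡i q))
      allL′ : ∀ k → p ≤ k → k < q - 1ℤ → paint R (q - 1ℤ) (q - 1ℤ + 1ℤ) ℓ k ≡ L
      allL′ k p≤k k<q-1 = trans (paint-below k<q-1) (allL k p≤k (<-≤-trans k<q-1 (<⇒≤ q-1<q)))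

module RecWalk (r s : ℕ) (x y : ℤ) (T : State) where

  h : ℤ
  h = y + + s - 1ℤ

  open Walk r s x h T public

  y≤h+1 : y ≤ h + 1ℤ
  y≤h+1 = subst (y ≤_) (sym (i-1+1≡i (y + + s))) (i≤i+j y (+ s))

  bounce : ∀ {a p c} → x ≤ a → a ≤ p → p ≤ c → c < y →
           Reaches (recLab y (c + 1ℤ)) (a - 1ℤ) → Reaches (paint L a p (recLab y c)) p
  bounce {a} {p} {c} x≤a a≤p p≤c c<y reach =
    sweepRight (≤-trans x≤a a≤p) p≤c (≤-trans (<⇒≤ c<y) y≤h+1)
               (λ k p≤k k<c → trans (paint-above p≤k) (recLab-below k<c)) $
    reaches-≗ (paint-mergeʳ a≤p p≤c) $
    subst (Reaches _) (i+1-1≡i c) $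
    sweepLeft x≤a (≤-trans a≤c (i≤i+1 c)) (≤-trans (<⇒+1≤ c<y) y≤h+1) allL $
    reaches-≗ (λ k → trans (paint-absorb ≤-refl (i≤i+1 c) k) (recLab-raise a≤c (i≤i+1 c) k)) reach
    where
    a≤c : a ≤ c
    a≤c = ≤-trans a≤p p≤c
    allL : ∀ k → a ≤ k → k < c + 1ℤ → paint L a c (recLab y c) k ≡ L
    allL k a≤k k<c+1 with <⊎≥ k c
    ... | inj₁ k<c = paint-inside a≤k k<c
    ... | inj₂ c≤k = trans (paint-above c≤k) (recLab-middle c≤k (≤-<-trans (<+1⇒≤ k<c+1) c<y))

  round : ∀ {a p c} → x ≤ a - 1ℤ → a ≤ p → p ≤ c → c < y →
          Reaches (paint L (a - 1ℤ) a (recLab y (c + 1ℤ))) a → Reaches (paint L a p (recLab y c)) p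
  round {a} {p} {c} x≤a-1 a≤p p≤c c<y reach =
    bounce (≤-trans x≤a-1 (i-1≤i a)) a≤p p≤c c<y $
    sweepRight x≤a-1 (i-1≤i a) (≤-trans a≤c (≤-trans (<⇒≤ c<y) y≤h+1))
               (λ k _ k<a → recLab-below (<-≤-trans k<a (≤-trans a≤c (i≤i+1 c)))) reach
    where
    a≤c : a ≤ c
    a≤c = ≤-trans a≤p p≤c

  start : ∀ {z} → x ≤ 0ℤ → 0ℤ ≤ y → x ≤ z → z ≤ y →
          (∀ {a c} → a + c ≡ z → x ≤ a → a ≤ 0ℤ → 0ℤ ≤ c → c ≤ y →
             Reaches (paint L a 0ℤ (recLab y c)) 0ℤ) →
          Reaches (recLab y z) 0ℤ
  start {z} x≤0 0≤y x≤z z≤y walk with <⊎≥ z 0ℤ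
  ... | inj₁ z<0 = reaches-≗ (λ k → sym (recLab-lower (<⇒≤ z<0) 0≤y k))
                     (walk (+-identityʳ z) x≤z (<⇒≤ z<0) ≤-refl 0≤y)
  ... | inj₂ 0≤z = reaches-≗ (λ k → sym (paint-empty k))
                     (walk (+-identityˡ z) x≤0 ≤-refl 0≤z z≤y)

module _ (r s : ℕ) (x y z : ℤ) where
  open RecWalk r s x y (recState s x (y + + s) (z - y))

  walkRight : x + y ≤ z → ∀ {a p c} → a + c ≡ z → a ≤ p → p ≤ c → c ≤ y →
              Reaches (paint L a p (recLab y c)) p
  walkRight x+y≤z a+c≡z a≤p p≤c c≤y =
    go (proj₁ (≤⇒∃+ c≤y)) (proj₂ (≤⇒∃+ c≤y)) a+c≡z a≤p p≤c
    where
    go : ∀ n {a p c} → c + + n ≡ y → a + c ≡ z → a ≤ p → p ≤ c →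
         Reaches (paint L a p (recLab y c)) p
    go zero {a} {p} {c} c+0≡y a+y≡z a≤p p≤y with trans (sym (+-identityʳ c)) c+0≡y
    ... | refl =
      sweepRight x≤p p≤h+1 ≤-refl (λ k p≤k _ → trans (paint-above p≤k) (recLab-diag y k)) $
      reaches-≗ (paint-mergeʳ a≤p p≤h+1) $
      _ , exitRight refl , refl , i+j-1+j≡i+j+j-1 y (+ s) , λ k _ _ → labels k
      where
      x≤p : x ≤ p
      x≤p = ≤-trans (i+j≤k+l∧l≤j⇒i≤k (subst (x + y ≤_) (sym a+y≡z) x+y≤z) ≤-refl) a≤p
      p≤h+1 : p ≤ h + 1ℤ
      p≤h+1 = ≤-trans p≤y y≤h+1
      labels : extendRight h (paint L a (h + 1ℤ) (recLab y y)) ≗ recLab (y + + s) (z - y)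
      labels k = begin
        extendRight h (paint L a (h + 1ℤ) (recLab y y)) k
          ≡⟨ extendRight-id h (λ j h<j → trans (paint-above (<⇒+1≤ h<j)) (recLab-diag y j)) k ⟩
        paint L a (h + 1ℤ) (recLab y y) k
          ≡⟨ paint-recLab-diag k ⟩
        recLab (h + 1ℤ) a k
          ≡⟨ cong₂ (λ b c → recLab b c k) (i-1+1≡i (y + + s))
                   (trans (sym (i+j-j≡i a y)) (cong (_- y) a+y≡z)) ⟩
        recLab (y + + s) (z - y) k ∎
        where open ≡-Reasoning
    go (suc m) {a} {p} {c} c+n≡y a+c≡z a≤p p≤c =
      round x≤a-1 a≤p p≤c (+1≤⇒< c+1≤y) $
      go m c+1+m≡y (trans (i-1+[j+1]≡i+j a c) a+c≡z) (i-1≤i a) (≤-trans (≤-trans a≤p p≤c) (i≤i+1 c))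
      where
      c+1+m≡y : c + 1ℤ + + m ≡ y
      c+1+m≡y = trans (+-assoc c 1ℤ (+ m)) c+n≡y
      c+1≤y : c + 1ℤ ≤ y
      c+1≤y = subst (c + 1ℤ ≤_) c+1+m≡y (i≤i+j (c + 1ℤ) (+ m))
      x≤a-1 : x ≤ a - 1ℤ
      x≤a-1 = i+j≤k+l∧l≤j⇒i≤k
                (subst (x + y ≤_) (sym (trans (i-1+[j+1]≡i+j a c) a+c≡z)) x+y≤z) c+1≤y

module _ (r s : ℕ) (x y z : ℤ) where
  open RecWalk r s x y (recState s (x - + r) y (z - x + 1ℤ))

  walkLeft : z < x + y → ∀ {a p c} → a + c ≡ z → x ≤ a → a ≤ p → p ≤ c →
             Reaches (paint L a p (recLab y c)) p
  walkLeft z<x+y a+c≡z x≤a = go (proj₁ (≤⇒∃+ x≤a)) (proj₂ (≤⇒∃+ x≤a)) a+c≡z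
    where
    c<y : ∀ {a c} → a + c ≡ z → x ≤ a → c < y
    c<y a+c≡z x≤a = i+j<k+l∧k≤i⇒j<l (subst (_< x + y) (sym a+c≡z) z<x+y) x≤a
    go : ∀ n {a p c} → x + + n ≡ a → a + c ≡ z → a ≤ p → p ≤ c →
         Reaches (paint L a p (recLab y c)) p
    go zero {a} {p} {c} x+0≡a x+c≡z x≤p p≤c with trans (sym (+-identityʳ x)) x+0≡a
    ... | refl =
      bounce ≤-refl x≤p p≤c (c<y x+c≡z ≤-refl) $
      _ , exitLeft refl , refl , refl , λ k _ _ → labels k
      where
      labels : extendLeft x (recLab y (c + 1ℤ)) ≗ recLab y (z - x + 1ℤ)
      labels k = begin
        extendLeft x (recLab y (c + 1ℤ)) k
          ≡⟨ extendLeft-id (λ j j<x → recLab-below (<-≤-trans j<x x≤c+1)) k ⟩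
        recLab y (c + 1ℤ) k
          ≡⟨ cong (λ t → recLab y (t + 1ℤ) k) (trans (sym (i+j-i≡j x c)) (cong (_- x) x+c≡z)) ⟩
        recLab y (z - x + 1ℤ) k ∎
        where
        open ≡-Reasoning
        x≤c+1 : x ≤ c + 1ℤ
        x≤c+1 = ≤-trans (≤-trans x≤p p≤c) (i≤i+1 c)
    go (suc m) {a} {p} {c} x+n≡a a+c≡z a≤p p≤c =
      round x≤a-1 a≤p p≤c (c<y a+c≡z (≤-trans x≤a-1 (i-1≤i a))) $
      go m x+m≡a-1 (trans (i-1+[j+1]≡i+j a c) a+c≡z) (i-1≤i a) (≤-trans (≤-trans a≤p p≤c) (i≤i+1 c))
      where
      x+m≡a-1 : x + + m ≡ a - 1ℤ
      x+m≡a-1 = trans (sym (i+[1+j]-1≡i+j x (+ m))) (cong (_- 1ℤ) x+n≡a)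
      x≤a-1 : x ≤ a - 1ℤ
      x≤a-1 = subst (x ≤_) x+m≡a-1 (i≤i+j x (+ m))

proposition2p5 : (r s : ℕ) → 1 Data.Nat.≤ r → 1 Data.Nat.≤ s →
    (x y z : ℤ) → x ≤ 0ℤ → 0ℤ ≤ y → x ≤ z → z ≤ y →
    (x + y ≤ z → r , s ⊢f recState s x y z ≈ recState s x (y + + s) (z - y))
    × (z < x + y → r , s ⊢f recState s x y z ≈ recState s (x - + r) y (z - x + 1ℤ))
proposition2p5 r s _ _ x y z x≤0 0≤y x≤z z≤y =
    (λ x+y≤z → RecWalk.start r s x y _ x≤0 0≤y x≤z z≤y
       (λ a+c≡z _ a≤0 0≤c c≤y → walkRight r s x y z x+y≤z a+c≡z a≤0 0≤c c≤y))
  , (λ z<x+y → RecWalk.start r s x y _ x≤0 0≤y x≤z z≤y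
       (λ a+c≡z x≤a a≤0 0≤c _ → walkLeft r s x y z z<x+y a+c≡z x≤a a≤0 0≤c))
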